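{- Let $G$ be a finite simple graph and let $A$ and $B$ be dominating sets of $G$ with $|A| = |B| = l$. If there is a path joining $A$ and $B$ in $D_{l+1}(G)$, then there exists a walk between $A$ and $B$ in $D_{l+1}(G)$ all of whose vertices are dominating sets of cardinality $l$ or $l+1$.
   Context: A set $S \subseteq V(G)$ is a dominating set of $G$ if every vertex of $V(G)\setminus S$ is adjacent to a vertex of $S$. For an integer $k$ at least the minimum cardinality of a dominating set of $G$, the $k$-dominating graph $D_k(G)$ is the graph whose vertices are the dominating sets of $G$ of cardinality at most $k$, two such sets $A,B$ being adjacent if and only if their symmetric difference $(A\setminus B)\cup(B\setminus A)$ consists of exactly one vertex of $G$. -}

module Defs where

open import Data.Nat using (ℕ; _≤_; suc)
open import Data.Fin using (Fin)
open import Data.Fin.Subset using (Subset; _∈_; _∪_; _─_; ⁅_⁆; ∣_∣)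
open import Data.Product using (Σ; ∃; _×_; _,_)
open import Data.Sum using (_⊎_)
open import Data.List using (List; []; _∷_)
open import Data.List.Relation.Unary.All using (All)
open import Data.List.Relation.Unary.Unique.Propositional using (Unique)
open import Relation.Nullary using (¬_)
open import Relation.Binary.PropositionalEquality using (_≡_)
open import Level using (0ℓ; suc)

record Graph (n : ℕ) : Set₁ where
  field
    Adj       : Fin n → Fin n → Set
    sym       : ∀ {u v} → Adj u v → Adj v u
    irrefl    : ∀ {v} → ¬ Adj v v

open Graph public

IsDominating : ∀ {n} → Graph n → Subset n → Set
IsDominating {n} G S = ∀ (v : Fin n) → ¬ (v ∈ S) → ∃ λ u → u ∈ S × Adj G u v

IsDkVertex : ∀ {n} → Graph n → ℕ → Subset n → Set
IsDkVertex G k S = IsDominating G S × ∣ S ∣ ≤ k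

SymDiffSingleton : ∀ {n} → Subset n → Subset n → Set
SymDiffSingleton A B = ∃ λ x → (A ─ B) ∪ (B ─ A) ≡ ⁅ x ⁆

data DkWalk {n} (G : Graph n) (k : ℕ) : Subset n → Subset n → List (Subset n) → Set where
  single : ∀ {A} → IsDkVertex G k A → DkWalk G k A A (A ∷ [])
  step   : ∀ {A C B vs} → IsDkVertex G k A → SymDiffSingleton A C →
           DkWalk G k C B vs → DkWalk G k A B (A ∷ vs)

DkPath : ∀ {n} → Graph n → ℕ → Subset n → Subset n → Set
DkPath G k A B = ∃ λ vs → DkWalk G k A B vs × Unique vs

module Submission where

-- Follow the given walk
-- A = S₀, S₁, …, Sₘ = B in D_{l+1}(G) while maintaining a shadow set T with
--   Sᵢ ⊆ T,  T dominating,  |T| ∈ {l, l+1},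
-- and build, backwards, a walk from the shadow to B through sets of size l or
-- l+1.  Initially T = A.  A step Sᵢ → Sᵢ₊₁ changes a single vertex x.  If x ∈ T
-- then Sᵢ₊₁ ⊆ T and the shadow stays.  Otherwise x is being added, so
-- |Sᵢ| ≤ l; we first shrink T to size l by deleting a vertex outside Sᵢ (it
-- stays dominating, being a superset of Sᵢ) and then add x.  At the end B ⊆ T,
-- and shrinking T to size l yields B itself.

open import Defs hiding (sym)
open import Data.Nat using (ℕ; suc; _≤_; _<_; s≤s; s≤s⁻¹)
open import Data.Nat.Properties using (≤-reflexive; ≤-trans; n≤1+n; ≤⇒≯; suc-injective)
open import Data.Bool using (not)
open import Data.Fin using (Fin; zero; suc; _≟_)
open import Data.Fin.Properties using (¬∀⟶∃¬)
open import Data.Fin.Subset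
  using (Subset; inside; outside; _∈_; _∉_; _⊆_; _∪_; _─_; ⁅_⁆; ∣_∣)
  renaming (⊥ to ∅)
open import Data.Fin.Subset.Properties using (_∈?_; ⊆-refl; ⊆-antisym; p⊆q⇒∣p∣≤∣q∣; p⊂q⇒∣p∣<∣q∣)
open import Data.Vec using ([]; _∷_; here; there)
open import Data.Vec.Properties using (∷-injectiveˡ; ∷-injectiveʳ)
open import Data.Product using (∃; _×_; _,_; proj₂)
open import Data.Sum using (_⊎_; inj₁; inj₂)
open import Data.List using ([]; _∷_)
open import Data.List.Relation.Unary.All using (All; []; _∷_)
open import Function using (_∘_; id)
open import Relation.Nullary using (¬_; yes; no; contradiction)
open import Relation.Nullary.Decidable using (_→-dec_)
open import Relation.Binary.PropositionalEquality
  using (_≡_; _≢_; refl; sym; trans; cong; subst)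

toggle : ∀ {n} → Subset n → Fin n → Subset n
toggle (s ∷ S) zero    = not s ∷ S
toggle (s ∷ S) (suc x) = s ∷ toggle S x

toggle-inserts : ∀ {n} {S : Subset n} {x} → x ∉ S → x ∈ toggle S x
toggle-inserts {S = inside  ∷ S} {zero}  x∉S = contradiction here x∉S
toggle-inserts {S = outside ∷ S} {zero}  _   = here
toggle-inserts {S = s ∷ S}       {suc x} x∉S = there (toggle-inserts (x∉S ∘ there))

toggle-keeps : ∀ {n} {S : Subset n} {x y} → y ≢ x → y ∈ S → y ∈ toggle S x
toggle-keeps {x = zero}  y≢x here      = contradiction refl y≢x
toggle-keeps {x = zero}  _   (there p) = there p
toggle-keeps {x = suc x} _   here      = here
toggle-keeps {x = suc x} y≢x (there p) = there (toggle-keeps (y≢x ∘ cong suc) p)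

toggle-keeps⁻ : ∀ {n} {S : Subset n} {x y} → y ≢ x → y ∈ toggle S x → y ∈ S
toggle-keeps⁻ {S = s ∷ S} {zero}  {zero}  y≢x _         = contradiction refl y≢x
toggle-keeps⁻ {S = s ∷ S} {zero}  {suc y} _   (there p) = there p
toggle-keeps⁻ {S = s ∷ S} {suc x} {zero}  _   here      = here
toggle-keeps⁻ {S = s ∷ S} {suc x} {suc y} y≢x (there p) =
  there (toggle-keeps⁻ (y≢x ∘ cong suc) p)

toggle-⊆ : ∀ {n} {S T : Subset n} {x} → S ⊆ T → x ∈ T → toggle S x ⊆ T
toggle-⊆ {x = x} S⊆T x∈T {y} y∈S' with y ≟ x
... | yes refl = x∈T
... | no  y≢x  = S⊆T (toggle-keeps⁻ y≢x y∈S')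

⊆-toggle : ∀ {n} {S T : Subset n} {x} → S ⊆ T → x ∉ S → S ⊆ toggle T x
⊆-toggle {x = x} S⊆T x∉S {y} y∈S with y ≟ x
... | yes refl = contradiction y∈S x∉S
... | no  y≢x  = toggle-keeps y≢x (S⊆T y∈S)

∣toggle∣-∉ : ∀ {n} {S : Subset n} {x} → x ∉ S → ∣ toggle S x ∣ ≡ suc ∣ S ∣
∣toggle∣-∉ {S = inside  ∷ S} {zero}  x∉S = contradiction here x∉S
∣toggle∣-∉ {S = outside ∷ S} {zero}  _   = refl
∣toggle∣-∉ {S = inside  ∷ S} {suc x} x∉S = cong suc (∣toggle∣-∉ (x∉S ∘ there))
∣toggle∣-∉ {S = outside ∷ S} {suc x} x∉S = ∣toggle∣-∉ (x∉S ∘ there)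

∣toggle∣-∈ : ∀ {n} {S : Subset n} {x} → x ∈ S → suc ∣ toggle S x ∣ ≡ ∣ S ∣
∣toggle∣-∈                   here      = refl
∣toggle∣-∈ {S = inside  ∷ S} (there p) = cong suc (∣toggle∣-∈ p)
∣toggle∣-∈ {S = outside ∷ S} (there p) = ∣toggle∣-∈ p

symDiff : ∀ {n} → Subset n → Subset n → Subset n
symDiff S C = (S ─ C) ∪ (C ─ S)

symDiff-self : ∀ {n} (S : Subset n) → symDiff S S ≡ ∅
symDiff-self []            = refl
symDiff-self (inside  ∷ S) = cong (outside ∷_) (symDiff-self S)
symDiff-self (outside ∷ S) = cong (outside ∷_) (symDiff-self S)

symDiff-∅ : ∀ {n} (S C : Subset n) → symDiff S C ≡ ∅ → C ≡ S
symDiff-∅ []            []            _ = refl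
symDiff-∅ (inside  ∷ S) (inside  ∷ C) e = cong (inside ∷_) (symDiff-∅ S C (∷-injectiveʳ e))
symDiff-∅ (outside ∷ S) (outside ∷ C) e = cong (outside ∷_) (symDiff-∅ S C (∷-injectiveʳ e))
symDiff-∅ (inside  ∷ S) (outside ∷ C) e with () ← ∷-injectiveˡ e
symDiff-∅ (outside ∷ S) (inside  ∷ C) e with () ← ∷-injectiveˡ e

symDiff-⁅⁆ : ∀ {n} (S C : Subset n) x → symDiff S C ≡ ⁅ x ⁆ → C ≡ toggle S x
symDiff-⁅⁆ (inside  ∷ S) (outside ∷ C) zero e = cong (outside ∷_) (symDiff-∅ S C (∷-injectiveʳ e))
symDiff-⁅⁆ (outside ∷ S) (inside  ∷ C) zero e = cong (inside ∷_) (symDiff-∅ S C (∷-injectiveʳ e))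
symDiff-⁅⁆ (inside  ∷ S) (inside  ∷ C) zero e with () ← ∷-injectiveˡ e
symDiff-⁅⁆ (outside ∷ S) (outside ∷ C) zero e with () ← ∷-injectiveˡ e
symDiff-⁅⁆ (inside  ∷ S) (inside  ∷ C) (suc x) e = cong (inside ∷_) (symDiff-⁅⁆ S C x (∷-injectiveʳ e))
symDiff-⁅⁆ (outside ∷ S) (outside ∷ C) (suc x) e = cong (outside ∷_) (symDiff-⁅⁆ S C x (∷-injectiveʳ e))
symDiff-⁅⁆ (inside  ∷ S) (outside ∷ C) (suc x) e with () ← ∷-injectiveˡ e
symDiff-⁅⁆ (outside ∷ S) (inside  ∷ C) (suc x) e with () ← ∷-injectiveˡ e

adjacent⇒toggle : ∀ {n} {S C : Subset n} → SymDiffSingleton S C → ∃ λ x → C ≡ toggle S x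
adjacent⇒toggle {S = S} {C} (x , e) = x , symDiff-⁅⁆ S C x e

toggle-adjacent : ∀ {n} (S : Subset n) x → SymDiffSingleton S (toggle S x)
toggle-adjacent S x = x , symDiff-toggle S x
  where
  symDiff-toggle : ∀ {n} (S : Subset n) x → symDiff S (toggle S x) ≡ ⁅ x ⁆
  symDiff-toggle (inside  ∷ S) zero    = cong (inside ∷_) (symDiff-self S)
  symDiff-toggle (outside ∷ S) zero    = cong (inside ∷_) (symDiff-self S)
  symDiff-toggle (inside  ∷ S) (suc x) = cong (outside ∷_) (symDiff-toggle S x)
  symDiff-toggle (outside ∷ S) (suc x) = cong (outside ∷_) (symDiff-toggle S x)

⊆-equal-size : ∀ {n} {S T : Subset n} → S ⊆ T → ∣ T ∣ ≤ ∣ S ∣ → S ≡ T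
⊆-equal-size {S = S} {T} S⊆T ∣T∣≤∣S∣ = ⊆-antisym S⊆T T⊆S
  where
  T⊆S : T ⊆ S
  T⊆S {i} i∈T with i ∈? S
  ... | yes i∈S = i∈S
  ... | no  i∉S = contradiction (p⊂q⇒∣p∣<∣q∣ (S⊆T , i , i∈T , i∉S)) (≤⇒≯ ∣T∣≤∣S∣)

larger-has-extra : ∀ {n} {S T : Subset n} → S ⊆ T → ∣ S ∣ < ∣ T ∣ → ∃ λ y → y ∈ T × y ∉ S
larger-has-extra {n} {S} {T} S⊆T ∣S∣<∣T∣ = extra (¬∀⟶∃¬ n _ (λ i → i ∈? T →-dec i ∈? S) T⊈S)
  where
  T⊈S : ¬ (∀ i → i ∈ T → i ∈ S)
  T⊈S T⊆S = ≤⇒≯ (p⊆q⇒∣p∣≤∣q∣ (T⊆S _)) ∣S∣<∣T∣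

  extra : (∃ λ i → ¬ (i ∈ T → i ∈ S)) → ∃ λ y → y ∈ T × y ∉ S
  extra (i , ¬T→S) with i ∈? T
  ... | yes i∈T = i , i∈T , λ i∈S → ¬T→S (λ _ → i∈S)
  ... | no  i∉T = contradiction (λ i∈T → contradiction i∈T i∉T) ¬T→S

dominating-⊆ : ∀ {n} {G : Graph n} {S T : Subset n} → IsDominating G S → S ⊆ T → IsDominating G T
dominating-⊆ {S = S} dS S⊆T v v∉T with v ∈? S
... | yes v∈S = contradiction (S⊆T v∈S) v∉T
... | no  v∉S with dS v v∉S
...   | u , u∈S , adj = u , S⊆T u∈S , adj

walk-head : ∀ {n} {G : Graph n} {k S B vs} → DkWalk G k S B vs → IsDkVertex G k S
walk-head (single v)   = v
walk-head (step v _ _) = v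

module Shadow {n} (G : Graph n) (l : ℕ) (B : Subset n) (∣B∣≡l : ∣ B ∣ ≡ l) where

  InBand : Subset n → Set
  InBand S = ∣ S ∣ ≡ l ⊎ ∣ S ∣ ≡ suc l

  Reaches : Subset n → Set
  Reaches T = ∃ λ ws → DkWalk G (suc l) T B ws × All InBand ws

  inBand-≤ : ∀ {S : Subset n} → InBand S → ∣ S ∣ ≤ suc l
  inBand-≤ (inj₁ e) = ≤-trans (≤-reflexive e) (n≤1+n l)
  inBand-≤ (inj₂ e) = ≤-reflexive e

  reaches-toggle : ∀ {T : Subset n} x → IsDominating G T → InBand T → Reaches (toggle T x) → Reaches T
  reaches-toggle {T} x dT bT (ws , w , all) =
    T ∷ ws , step (dT , inBand-≤ {T} bT) (toggle-adjacent T x) w , bT ∷ all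

  inserted-≤ : ∀ {S : Subset n} {x} → x ∉ S → ∣ toggle S x ∣ ≤ suc l → ∣ S ∣ ≤ l
  inserted-≤ x∉S ∣S'∣≤1+l = s≤s⁻¹ (≤-trans (≤-reflexive (sym (∣toggle∣-∉ x∉S))) ∣S'∣≤1+l)

  lower : ∀ {S T : Subset n} → S ⊆ T → ∣ S ∣ ≤ l → IsDominating G T → InBand T →
          ∃ λ T₁ → S ⊆ T₁ × T₁ ⊆ T × ∣ T₁ ∣ ≡ l × (Reaches T₁ → Reaches T)
  lower {T = T} S⊆T _ _ (inj₁ ∣T∣≡l) = T , S⊆T , id , ∣T∣≡l , id
  lower S⊆T ∣S∣≤l dT (inj₂ ∣T∣≡1+l)
    with larger-has-extra S⊆T (≤-trans (s≤s ∣S∣≤l) (≤-reflexive (sym ∣T∣≡1+l)))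
  ... | y , y∈T , y∉S =
    toggle _ y , ⊆-toggle S⊆T y∉S , toggle-⊆ ⊆-refl y∈T ,
    suc-injective (trans (∣toggle∣-∈ y∈T) ∣T∣≡1+l) , reaches-toggle y dT (inj₂ ∣T∣≡1+l)

  shadow : ∀ {S T : Subset n} {vs} → DkWalk G (suc l) S B vs → S ⊆ T → IsDominating G T → InBand T → Reaches T
  shadow (single (dB , _)) B⊆T dT bT with lower B⊆T (≤-reflexive ∣B∣≡l) dT bT
  ... | T₁ , B⊆T₁ , _ , ∣T₁∣≡l , back =
    back (subst Reaches B≡T₁ (B ∷ [] , single (dB , inBand-≤ {B} bB) , bB ∷ []))
    where
    bB : InBand B
    bB = inj₁ ∣B∣≡l
    B≡T₁ : B ≡ T₁
    B≡T₁ = ⊆-equal-size B⊆T₁ (≤-reflexive (trans ∣T₁∣≡l (sym ∣B∣≡l)))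
  shadow {T = T} (step (dS , _) adj w) S⊆T dT bT with adjacent⇒toggle adj
  ... | x , refl with x ∈? T
  ...   | yes x∈T = shadow w (toggle-⊆ S⊆T x∈T) dT bT
  ...   | no  x∉T with lower S⊆T (inserted-≤ (x∉T ∘ S⊆T) (proj₂ (walk-head w))) dT bT
  ...     | T₁ , S⊆T₁ , T₁⊆T , ∣T₁∣≡l , back =
    back (reaches-toggle x dT₁ (inj₁ ∣T₁∣≡l)
           (shadow w (toggle-⊆ (⊆-toggle S⊆T₁ (x∉T ∘ S⊆T)) (toggle-inserts x∉T₁)) dT₂ bT₂))
    where
    x∉T₁ : x ∉ T₁
    x∉T₁ = x∉T ∘ T₁⊆T
    dT₁ : IsDominating G T₁
    dT₁ = dominating-⊆ {G = G} dS S⊆T₁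
    dT₂ : IsDominating G (toggle T₁ x)
    dT₂ = dominating-⊆ {G = G} dT₁ (⊆-toggle ⊆-refl x∉T₁)
    bT₂ : InBand (toggle T₁ x)
    bT₂ = inj₂ (trans (∣toggle∣-∉ x∉T₁) (cong suc ∣T₁∣≡l))

lemma10 : ∀ {n} (G : Graph n) (l : ℕ) (A B : Subset n) →
    IsDominating G A → IsDominating G B → ∣ A ∣ ≡ l → ∣ B ∣ ≡ l →
    DkPath G (suc l) A B →
    ∃ λ vs → DkWalk G (suc l) A B vs × All (λ S → ∣ S ∣ ≡ l ⊎ ∣ S ∣ ≡ suc l) vs
lemma10 G l A B dA _ ∣A∣≡l ∣B∣≡l (_ , walk , _) =
  Shadow.shadow G l B ∣B∣≡l walk ⊆-refl dA (inj₁ ∣A∣≡l)
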